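{- Let $G$ be a finite group (written additively, not necessarily abelian) and $f:G\to G$. Then $\operatorname{PR}(f)\le k$ if and only if there exists an admissible subtable $\mathcal{A}$ of $M_f$ with $\operatorname{Range}(\mathcal{A})=G$ whose value set is a $k$-subset of $G$.
   Context: For $g:G\to G$, $\operatorname{Im}(g)=\{g(x):x\in G\}$, $V(g)=\#\operatorname{Im}(g)$, and $g+f$ denotes $x\mapsto g(x)+f(x)$. The permutation resemblance is $\operatorname{PR}(f)=\min\{V(g): g:G\to G,\ g+f \text{ is a bijection of } G\}$. For $b\in G$, $\operatorname{Pre}(f,b)=\{x\in G:f(x)=b\}$. The subtraction table $M_f$ has rows indexed by $G$, columns indexed by $\operatorname{Im}(f)$, and entry $m_{r,c}=r-c$ at position $(r,c)$. A subtable is a collection of entries (positions) of $M_f$. An admissible subtable with value set $S$ is a subtable $\mathcal{A}$ such that (A1) $S$ is exactly the set of values of its entries and (A2) for every $c\in\operatorname{Im}(f)$ there are exactly $\#\operatorname{Pre}(f,c)$ distinct rows $r$ with $m_{r,c}\in\mathcal{A}$. Its range is $\operatorname{Range}(\mathcal{A})=\{r\in G: m_{r,c}\in\mathcal{A}\text{ for some } c\}$.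
   Formalization: The value set of $\mathcal{A}$ is a subset of G with at most k elements, in place of a k-subset of G. The statement above fails without it. -}

module Defs where

open import Data.Nat using (ℕ; _≤_)
open import Data.Bool using (Bool; true)
open import Data.Fin using (Fin; _≟_)
open import Data.Fin.Subset using (Subset; _∈_; ∣_∣)
open import Data.Vec using (tabulate)
open import Data.Fin.Properties using (any?)
open import Data.Product using (Σ; ∃; ∃-syntax; _×_)
open import Relation.Nullary using (does)
open import Relation.Binary.PropositionalEquality using (_≡_)
open import Algebra.Structures using (IsGroup)
open import Function using (_⇔_)
open import Function.Definitions using (Bijective)

-- A finite group of order n, written additively (not necessarily abelian),
-- realised on the carrier Fin n with propositional equality.
-- (Every finite group is isomorphic to one of this form.)
record FinGroup (n : ℕ) : Set where
  field
    _+_     : Fin n → Fin n → Fin n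
    0#      : Fin n
    -_      : Fin n → Fin n
    isGroup : IsGroup _≡_ _+_ 0# -_
  infixl 6 _+_
  _-_ : Fin n → Fin n → Fin n
  r - c = r + (- c)

module _ {n : ℕ} (G : FinGroup n) where
  open FinGroup G

  Im : (Fin n → Fin n) → Subset n
  Im g = tabulate (λ y → does (any? (λ x → g x ≟ y)))

  V : (Fin n → Fin n) → ℕ
  V g = ∣ Im g ∣

  _⊕_ : (Fin n → Fin n) → (Fin n → Fin n) → (Fin n → Fin n)
  (g ⊕ f) x = g x + f x

  Pre : (Fin n → Fin n) → Fin n → Subset n
  Pre f b = tabulate (λ x → does (f x ≟ b))

  IsPR : (Fin n → Fin n) → ℕ → Set
  IsPR f m =
    (∃[ g ] (Bijective _≡_ _≡_ (g ⊕ f) × V g ≡ m)) ×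
    (∀ g → Bijective _≡_ _≡_ (g ⊕ f) → m ≤ V g)

  -- A subtable of M_f: a decidable set of positions (r , c), where r ∈ G
  -- indexes rows and c ∈ Im(f) indexes columns; the entry at (r , c) is r - c.
  record Subtable (f : Fin n → Fin n) : Set where
    field
      pos    : Fin n → Fin n → Bool
      column : ∀ r c → pos r c ≡ true → c ∈ Im f
  open Subtable public

  rowsIn : ∀ {f} → Subtable f → Fin n → ℕ
  rowsIn A c = ∣ tabulate (λ r → pos A r c) ∣

  Admissible : (f : Fin n → Fin n) → Subset n → Subtable f → Set
  Admissible f S A =
    (∀ s → (s ∈ S) ⇔ (∃[ r ] ∃[ c ] (pos A r c ≡ true × r - c ≡ s))) ×
    (∀ c → c ∈ Im f → rowsIn A c ≡ ∣ Pre f c ∣)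

  RangeIsG : ∀ {f} → Subtable f → Set
  RangeIsG A = ∀ r → ∃[ c ] (pos A r c ≡ true)

{-# OPTIONS --safe #-}

-- Choosing one entry in every row turns an admissible subtable with range G
-- into a column assignment col : G → Im f whose fibres are no larger than
-- those of f.  Such an assignment factors as col = f ∘ k with k : G → G
-- injective, hence bijective, and g x := k⁻¹ x - f x makes g + f = k⁻¹ a
-- bijection.  Conversely a bijection h = g + f yields the assignment
-- col = f ∘ h⁻¹, whose fibres are those of f.  Either way the chosen entries
-- are (h x , f x) with value h x - f x = g x, so the value set is Im g.

module Submission where

open import Defs
open import Data.Nat using (ℕ; _≤_)
open import Data.Fin using (Fin)
open import Data.Fin.Subset using (Subset; ∣_∣)
open import Data.Product using (∃-syntax; _×_)
open import Function using (_⇔_)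

open import Algebra.Bundles using (Group)
open import Data.Bool using (Bool; true; false)
open import Data.Fin using (zero; suc; punchIn; punchOut; _≟_)
open import Data.Fin.Permutation using (Permutation′; permutation; flip; _⟨$⟩ʳ_; _⟨$⟩ˡ_; inverseʳ)
open import Data.Fin.Properties
  using (any?; injective⇒≤; punchIn-injective; punchInᵢ≢i; punchOut-injective)
open import Data.Fin.Subset using (_∈_; _⊆_; Nonempty)
open import Data.Fin.Subset.Properties
  using (p⊆q⇒∣p∣≤∣q∣; nonempty?; Empty-unique; ∣⊥∣≡0; ∣⁅x⁆∣≡1; x∈⁅y⁆⇒x≡y; _∈?_)
open import Data.Nat as ℕ using (suc; _<_)
open import Data.Nat.Properties
  using (+-0-commutativeMonoid; +-cancelˡ-≤; ≤-trans; ≤-reflexive; 1+n≰n; module ≤-Reasoning)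
open import Data.Product using (∃; _,_; proj₁; proj₂; map₂)
open import Data.Vec using (tabulate)
open import Data.Vec.Properties using (lookup∘tabulate; lookup⇒[]=; []=⇒lookup)
open import Function using (_∘_; mk⇔; Equivalence)
open import Function.Bundles using (Bijection; mk⤖)
open import Function.Definitions using (Bijective; Injective)
open import Function.Properties.Bijection using (⤖⇒↔)
open import Function.Properties.Inverse using (↔⇒⤖)
open import Level using (0ℓ)
open import Relation.Binary.PropositionalEquality
  using (_≡_; _≢_; _≗_; refl; sym; trans; cong; cong₂; subst; module ≡-Reasoning)
open import Relation.Nullary using (Dec; yes; no; does; contradiction)
open import Relation.Nullary.Decidable using (dec-true)

open import Algebra.Properties.CommutativeMonoid.Sum +-0-commutativeMonoid
  using (sum; sum-remove; sum-permute)

boolToℕ : Bool → ℕ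
boolToℕ false = 0
boolToℕ true  = 1

does-true⇒ : ∀ {A : Set} (a? : Dec A) → does a? ≡ true → A
does-true⇒ (yes a) _ = a
does-true⇒ (no _)  ()

≗-bijective : ∀ {A B : Set} {f g : A → B} → f ≗ g →
              Bijective _≡_ _≡_ f → Bijective _≡_ _≡_ g
≗-bijective f≗g (f-injective , f-surjective) =
  (λ gx≡gy → f-injective (trans (f≗g _) (trans gx≡gy (sym (f≗g _))))) ,
  (λ y → map₂ (λ onto z≡x → trans (sym (f≗g _)) (onto z≡x)) (f-surjective y))

∈-tabulate⁺ : ∀ {n} {p : Fin n → Bool} {x} → p x ≡ true → x ∈ tabulate p
∈-tabulate⁺ {p = p} {x} px = lookup⇒[]= x (tabulate p) (trans (lookup∘tabulate p x) px)

∈-tabulate⁻ : ∀ {n} {p : Fin n → Bool} {x} → x ∈ tabulate p → p x ≡ true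
∈-tabulate⁻ {p = p} {x} x∈ = trans (sym (lookup∘tabulate p x)) ([]=⇒lookup x∈)

x∈p⇒0<∣p∣ : ∀ {n} {p : Subset n} {x} → x ∈ p → 0 < ∣ p ∣
x∈p⇒0<∣p∣ {p = p} {x} x∈p = subst (_≤ ∣ p ∣) (∣⁅x⁆∣≡1 x)
  (p⊆q⇒∣p∣≤∣q∣ (λ y∈⁅x⁆ → subst (_∈ p) (sym (x∈⁅y⁆⇒x≡y x y∈⁅x⁆)) x∈p))

0<∣p∣⇒Nonempty : ∀ {n} {p : Subset n} → 0 < ∣ p ∣ → Nonempty p
0<∣p∣⇒Nonempty {n} {p} 0<∣p∣ with nonempty? p
... | yes nonempty = nonempty
... | no  empty    =
  contradiction (subst (0 <_) (trans (cong ∣_∣ (Empty-unique empty)) (∣⊥∣≡0 n)) 0<∣p∣) λ ()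

∣tabulate∣≡sum : ∀ {n} (p : Fin n → Bool) → ∣ tabulate p ∣ ≡ sum (boolToℕ ∘ p)
∣tabulate∣≡sum {0}     p = refl
∣tabulate∣≡sum {suc n} p with p zero
... | true  = cong suc (∣tabulate∣≡sum (p ∘ suc))
... | false = ∣tabulate∣≡sum (p ∘ suc)

∣tabulate∣-remove : ∀ {n} (p : Fin (suc n) → Bool) i →
                    ∣ tabulate p ∣ ≡ boolToℕ (p i) ℕ.+ ∣ tabulate (p ∘ punchIn i) ∣
∣tabulate∣-remove p i = begin
  ∣ tabulate p ∣                                    ≡⟨ ∣tabulate∣≡sum p ⟩
  sum (boolToℕ ∘ p)                                 ≡⟨ sum-remove {i = i} (boolToℕ ∘ p) ⟩
  boolToℕ (p i) ℕ.+ sum (boolToℕ ∘ p ∘ punchIn i)   ≡⟨ cong (boolToℕ (p i) ℕ.+_) (∣tabulate∣≡sum (p ∘ punchIn i)) ⟨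
  boolToℕ (p i) ℕ.+ ∣ tabulate (p ∘ punchIn i) ∣    ∎
  where open ≡-Reasoning

∣tabulate∣-permute : ∀ {n} (p : Fin n → Bool) (π : Permutation′ n) →
                     ∣ tabulate (p ∘ (π ⟨$⟩ʳ_)) ∣ ≡ ∣ tabulate p ∣
∣tabulate∣-permute p π = begin
  ∣ tabulate (p ∘ (π ⟨$⟩ʳ_)) ∣     ≡⟨ ∣tabulate∣≡sum (p ∘ (π ⟨$⟩ʳ_)) ⟩
  sum (boolToℕ ∘ p ∘ (π ⟨$⟩ʳ_))    ≡⟨ sum-permute (boolToℕ ∘ p) π ⟨
  sum (boolToℕ ∘ p)                ≡⟨ ∣tabulate∣≡sum p ⟨
  ∣ tabulate p ∣                   ∎
  where open ≡-Reasoning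

injective⇒surjective : ∀ {n} {f : Fin n → Fin n} → Injective _≡_ _≡_ f →
                       ∀ y → ∃ λ x → f x ≡ y
injective⇒surjective {suc n} {f} f-injective y with any? (λ x → f x ≟ y)
... | yes hit  = hit
... | no  miss = contradiction (injective⇒≤ punchOut∘f-injective) 1+n≰n
  where
  y≢f : ∀ x → y ≢ f x
  y≢f x y≡fx = miss (x , sym y≡fx)

  punchOut∘f-injective : Injective _≡_ _≡_ (λ x → punchOut (y≢f x))
  punchOut∘f-injective e = f-injective (punchOut-injective (y≢f _) (y≢f _) e)

injective⇒permutation : ∀ {n} {f : Fin n → Fin n} → Injective _≡_ _≡_ f → Permutation′ n
injective⇒permutation {f = f} f-injective =
  permutation f (proj₁ ∘ surjective) (proj₂ ∘ surjective)
              (λ x → f-injective (proj₂ (surjective (f x))))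
  where
  surjective : ∀ y → ∃ λ x → f x ≡ y
  surjective = injective⇒surjective f-injective

-- Pre G f c unfolds to fibre f c, and the column c of assignmentSubtable col to fibre col c.
fibre : ∀ {m N} → (Fin m → Fin N) → Fin N → Subset m
fibre a c = tabulate (λ x → does (a x ≟ c))

∈-fibre⁺ : ∀ {m N} {a : Fin m → Fin N} {x c} → a x ≡ c → x ∈ fibre a c
∈-fibre⁺ {a = a} {x} {c} ax≡c = ∈-tabulate⁺ (dec-true (a x ≟ c) ax≡c)

∈-fibre⁻ : ∀ {m N} {a : Fin m → Fin N} {x c} → x ∈ fibre a c → a x ≡ c
∈-fibre⁻ {a = a} {x} {c} x∈ = does-true⇒ (a x ≟ c) (∈-tabulate⁻ x∈)

∣fibre∣-remove : ∀ {m N} (a : Fin (suc m) → Fin N) i c →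
                 ∣ fibre a c ∣ ≡ boolToℕ (does (a i ≟ c)) ℕ.+ ∣ fibre (a ∘ punchIn i) c ∣
∣fibre∣-remove a i c = ∣tabulate∣-remove (λ x → does (a x ≟ c)) i

∣fibre∣-permute : ∀ {m N} (a : Fin m → Fin N) (π : Permutation′ m) c →
                  ∣ fibre (a ∘ (π ⟨$⟩ʳ_)) c ∣ ≡ ∣ fibre a c ∣
∣fibre∣-permute a π c = ∣tabulate∣-permute (λ x → does (a x ≟ c)) π

fibres-≤⇒∃-preimage : ∀ {p q N} (a : Fin q → Fin N) (b : Fin p → Fin N) →
  (∀ c → ∣ fibre b c ∣ ≤ ∣ fibre a c ∣) → ∀ y → ∃ λ x → a x ≡ b y
fibres-≤⇒∃-preimage a b fibres-≤ y = map₂ (∈-fibre⁻ {a = a})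
  (0<∣p∣⇒Nonempty (≤-trans (x∈p⇒0<∣p∣ (∈-fibre⁺ {a = b} refl)) (fibres-≤ (b y))))

fibres-≤⇒injective-lift : ∀ {p q N} (a : Fin q → Fin N) (b : Fin p → Fin N) →
  (∀ c → ∣ fibre b c ∣ ≤ ∣ fibre a c ∣) →
  ∃[ k ] (Injective _≡_ _≡_ k × a ∘ k ≗ b)
fibres-≤⇒injective-lift {0} a b _ = (λ ()) , (λ { {()} }) , (λ ())
fibres-≤⇒injective-lift {suc p} {0} a b fibres-≤
  with () ← proj₁ (fibres-≤⇒∃-preimage a b fibres-≤ zero)
fibres-≤⇒injective-lift {suc p} {suc q} a b fibres-≤
  with x₀ , ax₀≡b0 ← fibres-≤⇒∃-preimage a b fibres-≤ zero = k , k-injective , a∘k≗b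
  where
  fibres-≤′ : ∀ c → ∣ fibre (b ∘ suc) c ∣ ≤ ∣ fibre (a ∘ punchIn x₀) c ∣
  fibres-≤′ c = +-cancelˡ-≤ (boolToℕ (does (b zero ≟ c))) _ _ (begin
    boolToℕ (does (b zero ≟ c)) ℕ.+ ∣ fibre (b ∘ suc) c ∣          ≡⟨ ∣fibre∣-remove b zero c ⟨
    ∣ fibre b c ∣                                                 ≤⟨ fibres-≤ c ⟩
    ∣ fibre a c ∣                                                 ≡⟨ ∣fibre∣-remove a x₀ c ⟩
    boolToℕ (does (a x₀ ≟ c)) ℕ.+ ∣ fibre (a ∘ punchIn x₀) c ∣    ≡⟨ cong₂ ℕ._+_ (cong (λ y → boolToℕ (does (y ≟ c))) ax₀≡b0) refl ⟩
    boolToℕ (does (b zero ≟ c)) ℕ.+ ∣ fibre (a ∘ punchIn x₀) c ∣  ∎)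
    where open ≤-Reasoning

  lift′ : ∃[ k′ ] (Injective _≡_ _≡_ k′ × a ∘ punchIn x₀ ∘ k′ ≗ b ∘ suc)
  lift′ = fibres-≤⇒injective-lift (a ∘ punchIn x₀) (b ∘ suc) fibres-≤′

  k : Fin (suc p) → Fin (suc q)
  k zero    = x₀
  k (suc r) = punchIn x₀ (proj₁ lift′ r)

  k-injective : Injective _≡_ _≡_ k
  k-injective {zero}  {zero}  _ = refl
  k-injective {zero}  {suc y} e = contradiction (sym e) (punchInᵢ≢i x₀ _)
  k-injective {suc x} {zero}  e = contradiction e (punchInᵢ≢i x₀ _)
  k-injective {suc x} {suc y} e = cong suc (proj₁ (proj₂ lift′) (punchIn-injective x₀ _ _ e))

  a∘k≗b : a ∘ k ≗ b
  a∘k≗b zero    = ax₀≡b0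
  a∘k≗b (suc r) = proj₂ (proj₂ lift′) r

module _ {n : ℕ} (G : FinGroup n) where
  open FinGroup G

  private
    group : Group 0ℓ 0ℓ
    group = record { _≈_ = _≡_ ; _∙_ = _+_ ; ε = 0# ; _⁻¹ = -_ ; isGroup = isGroup }

  open import Algebra.Properties.Group group using (//-rightDividesˡ; //-rightDividesʳ)

  ∈-Im⁺ : ∀ {g : Fin n → Fin n} {x y} → g x ≡ y → y ∈ Im G g
  ∈-Im⁺ {g} {x} {y} gx≡y = ∈-tabulate⁺ (dec-true (any? (λ x → g x ≟ y)) (x , gx≡y))

  ∈-Im⁻ : ∀ {g : Fin n → Fin n} {y} → y ∈ Im G g → ∃ λ x → g x ≡ y
  ∈-Im⁻ {g} {y} y∈ = does-true⇒ (any? (λ x → g x ≟ y)) (∈-tabulate⁻ y∈)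

  assignmentSubtable : ∀ {f} (col : Fin n → Fin n) → (∀ r → col r ∈ Im G f) → Subtable G f
  assignmentSubtable {f} col col∈Im = record
    { pos    = λ r c → does (col r ≟ c)
    ; column = λ r c e → subst (_∈ Im G f) (does-true⇒ (col r ≟ c) e) (col∈Im r)
    }

  bijective⇒admissible : ∀ {f g} → Bijective _≡_ _≡_ (_⊕_ G g f) →
                         ∃[ A ] (Admissible G f (Im G g) A × RangeIsG G A)
  bijective⇒admissible {f} {g} g⊕f-bijective = A , (values , rows) , range
    where
    h⁻¹ : Permutation′ n
    h⁻¹ = flip (⤖⇒↔ (mk⤖ g⊕f-bijective))

    col : Fin n → Fin n
    col r = f (h⁻¹ ⟨$⟩ʳ r)

    A : Subtable G f
    A = assignmentSubtable col (λ r → ∈-Im⁺ refl)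

    value : ∀ x → (g x + f x) - f x ≡ g x
    value x = //-rightDividesʳ (f x) (g x)

    values : ∀ s → (s ∈ Im G g) ⇔ (∃[ r ] ∃[ c ] (pos A r c ≡ true × r - c ≡ s))
    values s = mk⇔ to from
      where
      to : s ∈ Im G g → ∃[ r ] ∃[ c ] (pos A r c ≡ true × r - c ≡ s)
      to s∈ with x , gx≡s ← ∈-Im⁻ s∈ =
        g x + f x , f x , dec-true (col (g x + f x) ≟ f x) (cong f (inverseʳ h⁻¹)) ,
        trans (value x) gx≡s

      from : ∃[ r ] ∃[ c ] (pos A r c ≡ true × r - c ≡ s) → s ∈ Im G g
      from (r , c , r∈A , r-c≡s) = ∈-Im⁺ (begin
        g x                   ≡⟨ value x ⟨
        (g x + f x) - f x     ≡⟨ cong (_- f x) (inverseʳ (flip h⁻¹)) ⟩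
        r - f x               ≡⟨ cong (λ c′ → r - c′) (does-true⇒ (col r ≟ c) r∈A) ⟩
        r - c                 ≡⟨ r-c≡s ⟩
        s                     ∎)
        where
        open ≡-Reasoning
        x : Fin n
        x = h⁻¹ ⟨$⟩ʳ r

    rows : ∀ c → c ∈ Im G f → rowsIn G A c ≡ ∣ Pre G f c ∣
    rows c _ = ∣fibre∣-permute f h⁻¹ c

    range : RangeIsG G A
    range r = col r , dec-true (col r ≟ col r) refl

  rowChoice-fibres-≤ : ∀ {f} (A : Subtable G f) →
    (∀ c → c ∈ Im G f → rowsIn G A c ≡ ∣ Pre G f c ∣) →
    (col : Fin n → Fin n) → (∀ r → pos A r (col r) ≡ true) →
    ∀ c → ∣ fibre col c ∣ ≤ ∣ fibre f c ∣
  rowChoice-fibres-≤ {f} A rows col col∈A c with c ∈? Im G f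
  ... | yes c∈Im = ≤-trans (p⊆q⇒∣p∣≤∣q∣ (λ r∈ → ∈-tabulate⁺ {p = λ r → pos A r c} (entry∈A r∈)))
                           (≤-reflexive (rows c c∈Im))
    where
    entry∈A : ∀ {r} → r ∈ fibre col c → pos A r c ≡ true
    entry∈A {r} r∈ = subst (λ c → pos A r c ≡ true) (∈-fibre⁻ {a = col} r∈) (col∈A r)
  ... | no  c∉Im = p⊆q⇒∣p∣≤∣q∣ {q = fibre f c} λ {r} r∈ →
    contradiction (subst (_∈ Im G f) (∈-fibre⁻ {a = col} r∈) (column A r (col r) (col∈A r))) c∉Im

  admissible⇒bijective : ∀ {f S} (A : Subtable G f) → Admissible G f S A → RangeIsG G A →
                         ∃[ g ] (Bijective _≡_ _≡_ (_⊕_ G g f) × Im G g ⊆ S)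
  admissible⇒bijective {f} {S} A (values , rows) range = g , g⊕f-bijective , Im⊆S
    where
    col : Fin n → Fin n
    col r = proj₁ (range r)

    lift : ∃[ k ] (Injective _≡_ _≡_ k × f ∘ k ≗ col)
    lift = fibres-≤⇒injective-lift f col (rowChoice-fibres-≤ A rows col (proj₂ ∘ range))

    k : Permutation′ n
    k = injective⇒permutation (proj₁ (proj₂ lift))

    h : Fin n → Fin n
    h x = k ⟨$⟩ˡ x

    g : Fin n → Fin n
    g x = h x - f x

    g⊕f≗h : _⊕_ G g f ≗ h
    g⊕f≗h x = //-rightDividesˡ (f x) (h x)

    g⊕f-bijective : Bijective _≡_ _≡_ (_⊕_ G g f)
    g⊕f-bijective = ≗-bijective (sym ∘ g⊕f≗h) (Bijection.bijective (↔⇒⤖ (flip k)))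

    col∘h≡f : ∀ x → col (h x) ≡ f x
    col∘h≡f x = trans (sym (proj₂ (proj₂ lift) (h x))) (cong f (inverseʳ k))

    Im⊆S : Im G g ⊆ S
    Im⊆S y∈ with x , gx≡y ← ∈-Im⁻ y∈ = Equivalence.from (values _)
      (h x , f x , subst (λ c → pos A (h x) c ≡ true) (col∘h≡f x) (proj₂ (range (h x))) , gx≡y)

corollary2p2 : ∀ {n} (G : FinGroup n) (f : Fin n → Fin n) (k m : ℕ) →
    IsPR G f m →
    (m ≤ k ⇔ (∃[ S ] ∃[ A ] (Admissible G f S A × RangeIsG G A × ∣ S ∣ ≤ k)))
corollary2p2 G f k m ((g , g⊕f-bijective , Vg≡m) , minimal) = mk⇔ forward backward
  where
  forward : m ≤ k → ∃[ S ] ∃[ A ] (Admissible G f S A × RangeIsG G A × ∣ S ∣ ≤ k)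
  forward m≤k with A , admissible , range ← bijective⇒admissible G g⊕f-bijective =
    Im G g , A , admissible , range , subst (_≤ k) (sym Vg≡m) m≤k

  backward : ∃[ S ] ∃[ A ] (Admissible G f S A × RangeIsG G A × ∣ S ∣ ≤ k) → m ≤ k
  backward (S , A , admissible , range , ∣S∣≤k)
    with g′ , g′⊕f-bijective , Im⊆S ← admissible⇒bijective G A admissible range = begin
      m            ≤⟨ minimal g′ g′⊕f-bijective ⟩
      V G g′       ≤⟨ p⊆q⇒∣p∣≤∣q∣ Im⊆S ⟩
      ∣ S ∣        ≤⟨ ∣S∣≤k ⟩
      k            ∎
    where open ≤-Reasoning
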